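{- Let $G=(V,E)$ be a connected undirected graph and let $X_1,\dots,X_k$ be pairwise disjoint subsets of $V$ such that $G\setminus X_i$ is connected for every $i\in\{1,\dots,k\}$. Let $u,v$ be two vertices of $G$ not belonging to any of $X_1,\dots,X_k$, and suppose there is $j\in\{1,\dots,k\}$ such that $u$ and $v$ belong to different $2$-edge-connected components of $G\setminus X_j$. Let $G'$ be the graph obtained from $G$ by contracting every $X_i$ into a single marked vertex. Let $T$ be the tree of the $2$-edge-connected components of $G\setminus X_j$. Suppose that for every $i\in\{1,\dots,k\}\setminus\{j\}$, either (1) $X_i$ lies entirely within a node of $T$, or (2) a part of $X_i$ constitutes a leaf of $T$ and the remaining part of $X_i$ lies within the node of $T$ adjacent to that leaf. Then $u$ and $v$ belong to different marked vertex-edge blocks of $G'$.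
   Context: The tree of the $2$-edge-connected components of a connected undirected graph has one node for each $2$-edge-connected component (maximal set of vertices pairwise connected after deleting any single edge) and one tree edge for each bridge, joining the components containing its endpoints. For an undirected graph $G'$ with a set $V'$ of marked vertices, a marked vertex-edge block is a maximal subset $B\subseteq V(G')\setminus V'$ such that all vertices of $B$ remain in the same connected component of $G'\setminus\{w,e\}$ for every marked vertex $w$ and every edge $e$. -}

module Defs where

open import Data.Nat using (ℕ; zero; suc)
open import Data.Fin using (Fin; zero; suc)
open import Data.Fin.Subset using (Subset; _∈_; _∉_)
open import Data.Fin.Subset.Properties using (_∈?_)
open import Data.List using (List; length; lookup; map)
open import Data.Maybe using (Maybe; just; nothing; maybe)
import Data.Maybe as Maybe
open import Data.Product using (Σ; _×_; _,_; proj₁; proj₂)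
open import Data.Sum using (_⊎_; inj₁; inj₂)
open import Data.Unit using (⊤)
open import Data.Empty using (⊥)
open import Function using (_∘_)
open import Relation.Binary.PropositionalEquality using (_≡_; _≢_)
open import Relation.Nullary using (¬_; yes; no)

-- Finite undirected multigraphs on a vertex type V, given by an edge list.
-- An edge is identified by its position in the list; an edge (a , b)
-- can be traversed in both directions.

record Graph (V : Set) : Set where
  constructor graph
  field edges : List (V × V)

open Graph public

Edge : ∀ {V} → Graph V → Set
Edge G = Fin (length (edges G))

ends : ∀ {V} (G : Graph V) → Edge G → V × V
ends G e = lookup (edges G) e

Step : ∀ {V} (G : Graph V) (D : Edge G → Set) → V → V → Set
Step G D x z = Σ (Edge G) λ e → D e × (ends G e ≡ (x , z) ⊎ ends G e ≡ (z , x))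

data Reach {V : Set} (G : Graph V) (A : V → Set) (D : Edge G → Set) : V → V → Set where
  stop : ∀ {x} → A x → Reach G A D x x
  step : ∀ {x z y} → A x → Step G D x z → Reach G A D z y → Reach G A D x y

AllEdges : ∀ {V} (G : Graph V) → Edge G → Set
AllEdges G _ = ⊤

Connected : ∀ {V} (G : Graph V) (A : V → Set) → Set
Connected {V} G A = (x y : V) → A x → A y → Reach G A (AllEdges G) x y

SameTwoEC : ∀ {V} (G : Graph V) (A : V → Set) → V → V → Set
SameTwoEC G A x y =
  Reach G A (AllEdges G) x y × ((e : Edge G) → Reach G A (λ f → f ≢ e) x y)

IsBridge : ∀ {V} (G : Graph V) (A : V → Set) → Edge G → Set
IsBridge G A e =
  A (proj₁ (ends G e)) × A (proj₂ (ends G e)) ×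
  ¬ Reach G A (λ f → f ≢ e) (proj₁ (ends G e)) (proj₂ (ends G e))

-- the bridge e is a tree edge incident to the node (2-edge-connected component) of ℓ
IncidentBridge : ∀ {V} (G : Graph V) (A : V → Set) (ℓ : V) → Edge G → Set
IncidentBridge G A ℓ e =
  IsBridge G A e × (SameTwoEC G A (proj₁ (ends G e)) ℓ ⊎ SameTwoEC G A (proj₂ (ends G e)) ℓ)

-- the node of ℓ is a leaf of the tree T of 2-edge-connected components of H,
-- and b is its unique incident tree edge
IsLeafVia : ∀ {V} (G : Graph V) (A : V → Set) (ℓ : V) → Edge G → Set
IsLeafVia G A ℓ b =
  A ℓ × IncidentBridge G A ℓ b × ((e : Edge G) → IncidentBridge G A ℓ e → e ≡ b)

module _ {n k : ℕ} (G : Graph (Fin n)) (X : Fin k → Subset n) (j : Fin k) where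

  Hv : Fin n → Set
  Hv x = x ∉ X j

  WithinNode : Fin k → Set
  WithinNode i = Σ (Fin n) λ r → Hv r × ((x : Fin n) → x ∈ X i → SameTwoEC G Hv x r)

  -- (2) a part of X_i constitutes a leaf of T (the node of ℓ, whose
  -- unique tree edge is b), and the remaining part of X_i lies within the
  -- node adjacent to that leaf (the node of the endpoint of b outside the leaf)
  LeafAndNeighbour : Fin k → Set
  LeafAndNeighbour i =
    Σ (Fin n) λ ℓ → Σ (Edge G) λ b →
      IsLeafVia G Hv ℓ b ×
      ((y : Fin n) → Hv y → SameTwoEC G Hv y ℓ → y ∈ X i) ×
      ((x : Fin n) → x ∈ X i →
         SameTwoEC G Hv x ℓ ⊎
         Σ (Fin n) λ p → (p ≡ proj₁ (ends G b) ⊎ p ≡ proj₂ (ends G b)) ×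
                          ¬ SameTwoEC G Hv p ℓ × SameTwoEC G Hv x p)

-- Contraction of every X_i into a single marked vertex.
-- Vertices of G' are  inj₁ x  for x in no X_i, and the marked vertices inj₂ i.

which : ∀ {n k} → (Fin k → Subset n) → Fin n → Maybe (Fin k)
which {k = zero}  X x = nothing
which {k = suc k} X x with x ∈? X zero
... | yes _ = just zero
... | no  _ = Maybe.map suc (which (X ∘ suc) x)

module _ {n k : ℕ} (X : Fin k → Subset n) where

  contractV : Fin n → Fin n ⊎ Fin k
  contractV x = maybe inj₂ (inj₁ x) (which X x)

  VG' : Fin n ⊎ Fin k → Set
  VG' (inj₁ x) = which X x ≡ nothing
  VG' (inj₂ i) = ⊤

  contract : Graph (Fin n) → Graph (Fin n ⊎ Fin k)
  contract G = graph (map (λ p → contractV (proj₁ p) , contractV (proj₂ p)) (edges G))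

  -- edges of G' : images of edges of G, except those with both endpoints in the
  -- same X_i (which would become self-loops at a marked vertex and are discarded)
  EG' : (G : Graph (Fin n)) → Edge (contract G) → Set
  EG' G e = ¬ Σ (Fin k) λ i → ends (contract G) e ≡ (inj₂ i , inj₂ i)

module _ {W : Set} (G : Graph W) (VS : W → Set) (ES : Edge G → Set) (M : W → Set) where

  BlockProperty : (W → Set) → Set
  BlockProperty B =
    ((x : W) → B x → VS x × ¬ M x) ×
    ((x y : W) → B x → B y → (w : W) → VS w → M w → (e : Edge G) → ES e →
       Reach G (λ z → VS z × z ≢ w) (λ f → ES f × f ≢ e) x y)

  IsMarkedVertexEdgeBlock : (W → Set) → Set₁
  IsMarkedVertexEdgeBlock B =
    BlockProperty B × ((B' : W → Set) → BlockProperty B' → ((x : W) → B x → B' x) → (x : W) → B' x → B x)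

{-# OPTIONS --safe #-}
module Submission where

open import Defs
open import Data.Nat using (ℕ; zero; suc)
open import Data.Fin using (Fin; zero; suc; cast)
open import Data.Fin.Properties using (_≟_; cast-involutive)
open import Data.Fin.Subset using (Subset; _∈_; _∉_)
open import Data.Fin.Subset.Properties using (_∈?_)
open import Data.List using (List; _∷_; length; lookup; map)
open import Data.List.Properties using (length-map)
open import Data.Maybe using (just; nothing; maybe)
open import Data.Product using (Σ; _×_; _,_; proj₁; proj₂)
open import Data.Sum using (_⊎_; inj₁; inj₂)
open import Data.Unit using (⊤; tt)
open import Data.Empty using (⊥; ⊥-elim)
open import Function using (_∘_)
open import Relation.Binary.PropositionalEquality
  using (_≡_; _≢_; refl; sym; trans; cong; subst; ≢-sym)
open import Relation.Nullary using (¬_; yes; no)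
open import Relation.Nullary.Negation using (¬¬-map)

-- Fix an edge e; it suffices to show that u and v stay connected in
-- H = G ∖ X_j after deleting e (for each of the finitely many edges, up to
-- double negation).  The block property gives a walk from u to v in G' that
-- avoids the marked vertex X_j and the image of e, and such a walk lifts to
-- H ∖ e as soon as every other X_i stays connected in H ∖ e.  This holds when
-- X_i lies in a node of T (2-edge-connectivity), and when X_i is a leaf plus
-- part of its neighbour whose bridge b differs from e (cross b).  If e = b,
-- deleting e only cuts off the leaf, which lies inside X_i and thus contains
-- neither u nor v.  Finally, e does not become a loop of G': both its ends
-- would lie in one X_i, so e could be bypassed inside X_i (or is not even an
-- edge of H, if i = j).

private variable
  V : Set
  G : Graph V
  A : V → Set
  x y z : V


reach-source : ∀ {D : Edge G → Set} → Reach G A D x y → A x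
reach-source (stop a) = a
reach-source (step a _ _) = a

infixr 5 _++_
_++_ : ∀ {D : Edge G → Set} → Reach G A D x y → Reach G A D y z → Reach G A D x z
stop _ ++ r = r
step a s r ++ r′ = step a s (r ++ r′)

step-sym : ∀ {D : Edge G → Set} → Step G D x z → Step G D z x
step-sym (e , d , inj₁ p) = e , d , inj₂ p
step-sym (e , d , inj₂ p) = e , d , inj₁ p

reach-sym : ∀ {D : Edge G → Set} → Reach G A D x y → Reach G A D y x
reach-sym (stop a) = stop a
reach-sym {G = G} (step a s r) = reach-sym r ++ step (reach-source r) (step-sym {G = G} s) (stop a)

reach-map : ∀ {D D′ : Edge G → Set} → (∀ {x z} → A x → A z → Step G D x z → Reach G A D′ x z) →
            Reach G A D x y → Reach G A D′ x y
reach-map f (stop a) = stop a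
reach-map f (step a s r) = f a (reach-source r) s ++ reach-map f r

sameTwoEC-sym : SameTwoEC G A x y → SameTwoEC G A y x
sameTwoEC-sym (r , avoid) = reach-sym r , reach-sym ∘ avoid

sameTwoEC-trans : SameTwoEC G A x y → SameTwoEC G A y z → SameTwoEC G A x z
sameTwoEC-trans (r , avoid) (r′ , avoid′) = r ++ r′ , λ e → avoid e ++ avoid′ e

EndOf : (G : Graph V) → Edge G → V → Set
EndOf G e c = c ≡ proj₁ (ends G e) ⊎ c ≡ proj₂ (ends G e)

Linked : (G : Graph V) → (V → Set) → (Edge G → Set) → (V → Set) → Set
Linked G A D S = ∀ {x y} → S x → S y → Reach G A D x y

reach-avoid⊎reach-end : (e : Edge G) → Reach G A (AllEdges G) x y →
  Reach G A (_≢ e) x y ⊎ Σ _ λ c → EndOf G e c × Reach G A (_≢ e) x c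
reach-avoid⊎reach-end e (stop a) = inj₁ (stop a)
reach-avoid⊎reach-end e (step a (f , _ , o) r) with f ≟ e | o
... | yes refl | inj₁ eq = inj₂ (_ , inj₁ (sym (cong proj₁ eq)) , stop a)
... | yes refl | inj₂ eq = inj₂ (_ , inj₂ (sym (cong proj₂ eq)) , stop a)
... | no f≢e | _ with reach-avoid⊎reach-end e r
...   | inj₁ r′ = inj₁ (step a (f , f≢e , o) r′)
...   | inj₂ (c , c-end , r′) = inj₂ (c , c-end , step a (f , f≢e , o) r′)

reach-bypass : (e : Edge G) →
  (∀ {x z} → A x → A z → ends G e ≡ (x , z) → Reach G A (_≢ e) x z) →
  Reach G A (AllEdges G) x y → Reach G A (_≢ e) x y
reach-bypass {G = G} {A = A} e bypass = reach-map replace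
  where
  replace : ∀ {x z} → A x → A z → Step G (AllEdges G) x z → Reach G A (_≢ e) x z
  replace ax az (f , _ , o) with f ≟ e | o
  ... | yes refl | inj₁ eq = bypass ax az eq
  ... | yes refl | inj₂ eq = reach-sym (bypass az ax eq)
  ... | no f≢e | _ = step ax (f , f≢e , o) (stop az)

¬¬-∀-Fin : ∀ {m} {P : Fin m → Set} → (∀ i → ¬ ¬ P i) → ¬ ¬ (∀ i → P i)
¬¬-∀-Fin {zero} h k = k (λ ())
¬¬-∀-Fin {suc m} h k =
  h zero λ p₀ → ¬¬-∀-Fin (h ∘ suc) λ ps → k λ { zero → p₀ ; (suc i) → ps i }

pair-¬-unique : ∀ {P : V → Set} {p q c d : V} → c ≡ p ⊎ c ≡ q → d ≡ p ⊎ d ≡ q →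
                P p ⊎ P q → ¬ P c → ¬ P d → c ≡ d
pair-¬-unique (inj₁ refl) (inj₁ refl) _ _ _ = refl
pair-¬-unique (inj₂ refl) (inj₂ refl) _ _ _ = refl
pair-¬-unique (inj₁ refl) (inj₂ refl) (inj₁ Pp) ¬Pc _ = ⊥-elim (¬Pc Pp)
pair-¬-unique (inj₁ refl) (inj₂ refl) (inj₂ Pq) _ ¬Pd = ⊥-elim (¬Pd Pq)
pair-¬-unique (inj₂ refl) (inj₁ refl) (inj₁ Pp) _ ¬Pd = ⊥-elim (¬Pd Pp)
pair-¬-unique (inj₂ refl) (inj₁ refl) (inj₂ Pq) ¬Pc _ = ⊥-elim (¬Pc Pq)

module Leaf {ℓ : V} {b : Edge G} (leaf : IsLeafVia G A ℓ b) where

  private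
    bridge : IncidentBridge G A ℓ b
    bridge = proj₁ (proj₂ leaf)

    end₁∈A : A (proj₁ (ends G b))
    end₁∈A = proj₁ (proj₁ bridge)

    end₂∈A : A (proj₂ (ends G b))
    end₂∈A = proj₁ (proj₂ (proj₁ bridge))

  incidentBridge-of-ends : ∀ {f p q} → ends G f ≡ (p , q) → A p → A q →
    ¬ Reach G A (_≢ f) p q → SameTwoEC G A p ℓ ⊎ SameTwoEC G A q ℓ →
    IncidentBridge G A ℓ f
  incidentBridge-of-ends eq ap aq ¬r near rewrite eq = (ap , aq , ¬r) , near

  incidentBridge-of-step : ∀ {a c f} → A a → A c → SameTwoEC G A a ℓ →
    ends G f ≡ (a , c) ⊎ ends G f ≡ (c , a) → ¬ Reach G A (_≢ f) a c →
    IncidentBridge G A ℓ f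
  incidentBridge-of-step aa ac aℓ (inj₁ eq) ¬r = incidentBridge-of-ends eq aa ac ¬r (inj₁ aℓ)
  incidentBridge-of-step aa ac aℓ (inj₂ eq) ¬r =
    incidentBridge-of-ends eq ac aa (¬r ∘ reach-sym) (inj₂ aℓ)

  -- An edge other than b leaving the leaf would be a second tree edge at it
  -- if it were a bridge.
  leaf-step : ∀ {a c} → SameTwoEC G A a ℓ → A a → A c → Step G (_≢ b) a c →
              ¬ ¬ SameTwoEC G A a c
  leaf-step aℓ aa ac (f , f≢b , o) = ¬¬-map (direct ,_) (¬¬-∀-Fin avoid)
    where
    direct : Reach G A (AllEdges G) _ _
    direct = step aa (f , tt , o) (stop ac)
    avoid : ∀ g → ¬ ¬ Reach G A (_≢ g) _ _
    avoid g ¬r with g ≟ f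
    ... | no g≢f = ¬r (step aa (f , ≢-sym g≢f , o) (stop ac))
    ... | yes refl = f≢b (proj₂ (proj₂ leaf) g (incidentBridge-of-step aa ac aℓ o ¬r))

  leaf-closed : ∀ {a z} → SameTwoEC G A a ℓ → Reach G A (_≢ b) a z →
                ¬ ¬ SameTwoEC G A z ℓ
  leaf-closed aℓ (stop _) k = k aℓ
  leaf-closed aℓ (step aa s r) k = leaf-step aℓ aa (reach-source r) s λ ac →
    leaf-closed (sameTwoEC-trans (sameTwoEC-sym ac) aℓ) r k

  far-end⇝leaf : ∀ {p e} → b ≢ e → EndOf G b p → ¬ SameTwoEC G A p ℓ →
                 Reach G A (_≢ e) p ℓ
  far-end⇝leaf {e = e} b≢e p-end p≁ℓ = cross p-end p≁ℓ (proj₂ bridge)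
    where
    cross : ∀ {p} → EndOf G b p → ¬ SameTwoEC G A p ℓ →
      SameTwoEC G A (proj₁ (ends G b)) ℓ ⊎ SameTwoEC G A (proj₂ (ends G b)) ℓ →
      Reach G A (_≢ e) p ℓ
    cross (inj₁ refl) _ (inj₂ near) = step end₁∈A (b , b≢e , inj₁ refl) (proj₂ near e)
    cross (inj₂ refl) _ (inj₁ near) = step end₂∈A (b , b≢e , inj₂ refl) (proj₂ near e)
    cross (inj₁ refl) p≁ℓ (inj₁ near) = ⊥-elim (p≁ℓ near)
    cross (inj₂ refl) p≁ℓ (inj₂ near) = ⊥-elim (p≁ℓ near)

  -- Every vertex outside the leaf reaches the end of b outside the leaf
  -- without using b.
  outside-connected : Connected G A → ∀ {u v} → A u → A v →
    ¬ SameTwoEC G A u ℓ → ¬ SameTwoEC G A v ℓ → Reach G A (_≢ b) u v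
  outside-connected connected {u} {v} au av u≁ℓ v≁ℓ = join (to-end au) (to-end av)
    where
    EndReach : V → Set
    EndReach w = Σ _ λ c → EndOf G b c × Reach G A (_≢ b) w c
    to-end : ∀ {w} → A w → EndReach w
    to-end aw with reach-avoid⊎reach-end b (connected _ _ aw end₁∈A)
    ... | inj₁ r = _ , inj₁ refl , r
    ... | inj₂ hit = hit
    far : ∀ {w c} → ¬ SameTwoEC G A w ℓ → Reach G A (_≢ b) w c → ¬ SameTwoEC G A c ℓ
    far w≁ℓ w⇝c cℓ = leaf-closed
      (stop (proj₁ leaf) , λ _ → stop (proj₁ leaf))
      (reach-sym (proj₂ cℓ b) ++ reach-sym w⇝c) w≁ℓ
    join : EndReach u → EndReach v → Reach G A (_≢ b) u v
    join (c , c-end , u⇝c) (d , d-end , v⇝d) =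
      subst (Reach G A (_≢ b) u)
        (pair-¬-unique c-end d-end (proj₂ bridge) (far u≁ℓ u⇝c) (far v≁ℓ v⇝d))
        u⇝c
      ++ reach-sym v⇝d

lookup-map : ∀ {B C : Set} (f : B → C) (xs : List B) (i : Fin (length (map f xs))) →
             lookup (map f xs) i ≡ f (lookup xs (cast (length-map f xs) i))
lookup-map f (x ∷ xs) zero = refl
lookup-map f (x ∷ xs) (suc i) = lookup-map f xs i

which-sound : ∀ {n k} (X : Fin k → Subset n) {x i} → which X x ≡ just i → x ∈ X i
which-sound {k = suc k} X {x} eq with x ∈? X zero
which-sound {k = suc k} X refl | yes x∈X₀ = x∈X₀
... | no _ with which (X ∘ suc) x in eq′
which-sound {k = suc k} X refl | no _ | just _ = which-sound (X ∘ suc) eq′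

which-complete : ∀ {n k} (X : Fin k → Subset n) {x i} → x ∈ X i →
                 Σ (Fin k) λ i′ → which X x ≡ just i′
which-complete {k = suc k} X {x} x∈Xi with x ∈? X zero
... | yes _ = zero , refl
which-complete {k = suc k} X {i = zero} x∈Xi | no x∉X₀ = ⊥-elim (x∉X₀ x∈Xi)
which-complete {k = suc k} X {i = suc i} x∈Xi | no _ with which-complete (X ∘ suc) x∈Xi
... | i′ , eq rewrite eq = suc i′ , refl

which-outside : ∀ {n k} (X : Fin k → Subset n) {x} → (∀ i → x ∉ X i) → which X x ≡ nothing
which-outside {k = zero} X _ = refl
which-outside {k = suc k} X {x} x∉ with x ∈? X zero
... | yes x∈X₀ = ⊥-elim (x∉ zero x∈X₀)
... | no _ rewrite which-outside (X ∘ suc) (x∉ ∘ suc) = refl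

module _ {n k : ℕ} (X : Fin k → Subset n) where

  contractV-outside : ∀ {x} → (∀ i → x ∉ X i) → contractV X x ≡ inj₁ x
  contractV-outside {x} x∉ = cong (maybe inj₂ (inj₁ x)) (which-outside X x∉)

  contractV-inj₁ : ∀ {x z} → contractV X x ≡ inj₁ z → x ≡ z
  contractV-inj₁ {x} eq with which X x
  contractV-inj₁ refl | nothing = refl

  contractV-inj₂ : ∀ {x i} → contractV X x ≡ inj₂ i → x ∈ X i
  contractV-inj₂ {x} eq with which X x in w
  contractV-inj₂ refl | just _ = which-sound X w

  contractPair : Fin n × Fin n → (Fin n ⊎ Fin k) × (Fin n ⊎ Fin k)
  contractPair (x , y) = contractV X x , contractV X y

  module _ (G : Graph (Fin n)) where

    private
      length-edges : length (edges (contract X G)) ≡ length (edges G)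
      length-edges = length-map contractPair (edges G)

    edgeImage : Edge G → Edge (contract X G)
    edgeImage = cast (sym length-edges)

    edgePreimage : Edge (contract X G) → Edge G
    edgePreimage = cast length-edges

    ends-contract : ∀ f → ends (contract X G) f ≡ contractPair (ends G (edgePreimage f))
    ends-contract = lookup-map contractPair (edges G)

    ends-edgeImage : ∀ e → ends (contract X G) (edgeImage e) ≡ contractPair (ends G e)
    ends-edgeImage e = trans (ends-contract (edgeImage e))
      (cong (contractPair ∘ ends G) (cast-involutive length-edges (sym length-edges) e))

    edgePreimage-≢ : ∀ {f e} → f ≢ edgeImage e → edgePreimage f ≢ e
    edgePreimage-≢ {f} f≢e refl = f≢e (sym (cast-involutive (sym length-edges) length-edges f))

module _ {n k : ℕ} {G : Graph (Fin n)} {X : Fin k → Subset n} {j : Fin k} where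

  private
    H : Fin n → Set
    H = Hv G X j

  withinNode-linked : ∀ {i} → WithinNode G X j i → (e : Edge G) →
                      Linked G H (_≢ e) (_∈ X i)
  withinNode-linked (_ , _ , near) e xi yi =
    proj₂ (near _ xi) e ++ reach-sym (proj₂ (near _ yi) e)

  leafBridge : ∀ {i} → LeafAndNeighbour G X j i → Edge G
  leafBridge = proj₁ ∘ proj₂

  leafAndNeighbour-linked : ∀ {i} (L : LeafAndNeighbour G X j i) (e : Edge G) →
    leafBridge L ≢ e → Linked G H (_≢ e) (_∈ X i)
  leafAndNeighbour-linked {i} (ℓ , b , leaf , _ , parts) e b≢e xi yi =
    to-leaf xi ++ reach-sym (to-leaf yi)
    where
    open Leaf leaf
    to-leaf : ∀ {x} → x ∈ X i → Reach G H (_≢ e) x ℓ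
    to-leaf {x} xi with parts x xi
    ... | inj₁ xℓ = proj₂ xℓ e
    ... | inj₂ (p , p-end , p≁ℓ , xp) = proj₂ xp e ++ far-end⇝leaf b≢e p-end p≁ℓ

  leafAndNeighbour-outside-connected : ∀ {i} (L : LeafAndNeighbour G X j i) →
    Connected G H → ∀ {u v} → H u → H v → u ∉ X i → v ∉ X i →
    Reach G H (_≢ leafBridge L) u v
  leafAndNeighbour-outside-connected (_ , _ , leaf , in-leaf , _) connected hu hv u∉ v∉ =
    outside-connected connected hu hv (u∉ ∘ in-leaf _ hu) (v∉ ∘ in-leaf _ hv)
    where open Leaf leaf

  module _ (disjoint : (i i′ : Fin k) → i ≢ i′ → (x : Fin n) → x ∈ X i → x ∈ X i′ → ⊥) where

    contractV≢marked : ∀ {x} → contractV X x ≢ inj₂ j → H x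
    contractV≢marked {x} ≢j x∈Xj with which-complete X x∈Xj
    ... | i , eq with i ≟ j
    ...   | yes refl = ≢j (cong (maybe inj₂ (inj₁ x)) eq)
    ...   | no i≢j = disjoint i j i≢j x (which-sound X eq) x∈Xj

    module _ {D : Edge G → Set} (linked : ∀ i → i ≢ j → Linked G H D (_∈ X i)) where

      same-image : ∀ {x y s} → s ≢ inj₂ j → contractV X x ≡ s → contractV X y ≡ s →
                   Reach G H D x y
      same-image {x} {s = inj₁ z} s≢j xz yz =
        subst (Reach G H D x) (trans (contractV-inj₁ X xz) (sym (contractV-inj₁ X yz)))
          (stop (contractV≢marked (s≢j ∘ trans (sym xz))))
      same-image {s = inj₂ i} s≢j xi yi =
        linked i (s≢j ∘ cong inj₂) (contractV-inj₂ X xi) (contractV-inj₂ X yi)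

      lift-edge : ∀ {f s t x} → s ≢ inj₂ j → t ≢ inj₂ j → D (edgePreimage X G f) →
        ends (contract X G) f ≡ (s , t) ⊎ ends (contract X G) f ≡ (t , s) →
        contractV X x ≡ s → Σ (Fin n) λ c → contractV X c ≡ t × Reach G H D x c
      lift-edge {f} s≢j t≢j d (inj₁ eq) xs =
        _ , cong proj₂ eq′ ,
        same-image s≢j xs (cong proj₁ eq′) ++
        step (contractV≢marked (s≢j ∘ trans (sym (cong proj₁ eq′))))
             (edgePreimage X G f , d , inj₁ refl)
             (stop (contractV≢marked (t≢j ∘ trans (sym (cong proj₂ eq′)))))
        where
        eq′ : contractPair X (ends G (edgePreimage X G f)) ≡ (_ , _)
        eq′ = trans (sym (ends-contract X G f)) eq
      lift-edge {f} s≢j t≢j d (inj₂ eq) xs =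
        _ , cong proj₁ eq′ ,
        same-image s≢j xs (cong proj₂ eq′) ++
        step (contractV≢marked (s≢j ∘ trans (sym (cong proj₂ eq′))))
             (edgePreimage X G f , d , inj₂ refl)
             (stop (contractV≢marked (t≢j ∘ trans (sym (cong proj₁ eq′)))))
        where
        eq′ : contractPair X (ends G (edgePreimage X G f)) ≡ (_ , _)
        eq′ = trans (sym (ends-contract X G f)) eq

      lift-walk : ∀ {D′ s t x y} → (∀ {f} → D′ f → D (edgePreimage X G f)) →
        Reach (contract X G) (λ w → VG' X w × w ≢ inj₂ j) D′ s t →
        contractV X x ≡ s → contractV X y ≡ t → Reach G H D x y
      lift-walk _ (stop (_ , s≢j)) xs ys = same-image s≢j xs ys
      lift-walk preimage (step (_ , s≢j) (f , d , o) r) xs yt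
        with lift-edge s≢j (proj₂ (reach-source r)) (preimage d) o xs
      ... | c , cz , x⇝c = x⇝c ++ lift-walk preimage r cz yt

    contracted-loop-bypass : ∀ {e x y} → (∀ i → i ≢ j → Linked G H (_≢ e) (_∈ X i)) →
      Σ (Fin k) (λ i → ends (contract X G) (edgeImage X G e) ≡ (inj₂ i , inj₂ i)) →
      Reach G H (AllEdges G) x y → Reach G H (_≢ e) x y
    contracted-loop-bypass {e} linked (i , loop) = reach-bypass e bypass
      where
      ends∈Xi : proj₁ (ends G e) ∈ X i × proj₂ (ends G e) ∈ X i
      ends∈Xi = contractV-inj₂ X (cong proj₁ eq) , contractV-inj₂ X (cong proj₂ eq)
        where
        eq : contractPair X (ends G e) ≡ (inj₂ i , inj₂ i)
        eq = trans (sym (ends-edgeImage X G e)) loop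
      bypass : ∀ {a c} → H a → H c → ends G e ≡ (a , c) → Reach G H (_≢ e) a c
      bypass ha hc refl with i ≟ j
      ... | yes refl = ⊥-elim (ha (proj₁ ends∈Xi))
      ... | no i≢j = linked i i≢j (proj₁ ends∈Xi) (proj₂ ends∈Xi)

  -- Only the bridge of a leaf could disconnect some X_i, and deleting it
  -- disconnects nothing outside the leaf, in particular not u from v.
  marked-linked : Connected G H → ∀ {u v} → (∀ i → u ∉ X i) → (∀ i → v ∉ X i) →
    ((i : Fin k) → i ≢ j → WithinNode G X j i ⊎ LeafAndNeighbour G X j i) →
    ∀ e → ¬ Reach G H (_≢ e) u v → ∀ i → i ≢ j → Linked G H (_≢ e) (_∈ X i)
  marked-linked connected u∉ v∉ cases e ¬u⇝v i i≢j with cases i i≢j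
  ... | inj₁ within = withinNode-linked within e
  ... | inj₂ L with leafBridge L ≟ e
  ...   | no b≢e = leafAndNeighbour-linked L e b≢e
  ...   | yes refl = ⊥-elim (¬u⇝v
          (leafAndNeighbour-outside-connected L connected (u∉ j) (v∉ j) (u∉ i) (v∉ i)))

lemma23 : {n k : ℕ} (G : Graph (Fin n)) (X : Fin k → Subset n) →
    Connected G (λ _ → ⊤) →
    ((i i' : Fin k) → i ≢ i' → (x : Fin n) → x ∈ X i → x ∈ X i' → ⊥) →
    ((i : Fin k) → Connected G (λ x → x ∉ X i)) →
    (u v : Fin n) → ((i : Fin k) → u ∉ X i) → ((i : Fin k) → v ∉ X i) →
    (j : Fin k) → ¬ SameTwoEC G (λ x → x ∉ X j) u v →
    ((i : Fin k) → i ≢ j → WithinNode G X j i ⊎ LeafAndNeighbour G X j i) →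
    (B : Fin n ⊎ Fin k → Set) →
    IsMarkedVertexEdgeBlock (contract X G) (VG' X) (EG' X G) (λ w → Σ (Fin k) (λ i → w ≡ inj₂ i)) B →
    B (inj₁ u) → B (inj₁ v) → ⊥
lemma23 G X _ disjoint connected u v u∉ v∉ j u≁v cases _ block u∈B v∈B =
  ¬¬-∀-Fin u⇝v-avoiding λ avoiding → u≁v (u⇝v , avoiding)
  where
  u⇝v : Reach G (Hv G X j) (AllEdges G) u v
  u⇝v = connected j u v (u∉ j) (v∉ j)
  u⇝v-avoiding : ∀ e → ¬ ¬ Reach G (Hv G X j) (_≢ e) u v
  u⇝v-avoiding e ¬u⇝v = ¬u⇝v (lift-walk disjoint linked (edgePreimage-≢ X G ∘ proj₂)
      (proj₂ (proj₁ block) _ _ u∈B v∈B (inj₂ j) tt (j , refl) (edgeImage X G e)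
         λ loop → ¬u⇝v (contracted-loop-bypass disjoint linked loop u⇝v))
      (contractV-outside X u∉) (contractV-outside X v∉))
    where
    linked : ∀ i → i ≢ j → Linked G (Hv G X j) (_≢ e) (_∈ X i)
    linked = marked-linked (connected j) u∉ v∉ cases e ¬u⇝v
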